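{- Let $\lambda,x$ be indeterminates and $P=(p_{ij})_{i,j\ge0}$ the matrix with $p_{n,n+1}=1$, $p_{n,n}=2n+\lambda+x$, $p_{n,n-1}=n(n-1+\lambda)+2nx$, $p_{n,n-2}=n(n-1)x$, and all other entries $0$. (a) $P=L(LU_x+\lambda I)$, where $L$ is the lower-bidiagonal matrix with $L_{n,n}=1$, $L_{n,n-1}=n$ (all other entries $0$), and $U_x=\Delta+xI$ is the upper-bidiagonal matrix with $1$ on the superdiagonal and $x$ on the diagonal. (b) $P$ is totally positive in $\mathbb Z[x,\lambda]$ equipped with the coefficientwise order.
   Context: $\Delta$ denotes the matrix with entries $\Delta_{i,i+1}=1$ and $0$ elsewhere; $I$ is the identity matrix. Coefficientwise total positivity: all minors are polynomials with nonnegative coefficients. -}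

module Defs where

open import Data.Nat as ℕ using (ℕ; zero; suc; _∸_; _≟_)
open import Data.Integer as ℤ using (ℤ; +_; 0ℤ; 1ℤ; -1ℤ)
open import Data.Fin as Fin using (Fin; zero; suc; punchIn; toℕ)
open import Data.Bool using (if_then_else_)
open import Relation.Nullary.Decidable using (⌊_⌋)
open import Relation.Binary.PropositionalEquality using (_≡_)
open import Data.Product using (_×_)

-- An element of ℤ[[x,λ]] is its coefficient function: s a b is the
-- coefficient of x^a λ^b.  ℤ[x,λ] embeds in it (ring embedding, and
-- coefficientwise order is preserved), and all entries / minors below
-- are polynomials.

Series : Set
Series = ℕ → ℕ → ℤ

_≈ₛ_ : Series → Series → Set
s ≈ₛ t = ∀ a b → s a b ≡ t a b

sumℤ : ℕ → (ℕ → ℤ) → ℤ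
sumℤ zero    f = 0ℤ
sumℤ (suc n) f = sumℤ n f ℤ.+ f n

_+ₛ_ : Series → Series → Series
(s +ₛ t) a b = s a b ℤ.+ t a b

-ₛ_ : Series → Series
(-ₛ s) a b = ℤ.- (s a b)

_*ₛ_ : Series → Series → Series
(s *ₛ t) a b =
  sumℤ (suc a) (λ i → sumℤ (suc b) (λ j → s i j ℤ.* t (a ∸ i) (b ∸ j)))

cst : ℤ → Series
cst c zero zero = c
cst c _    _    = 0ℤ

nat : ℕ → Series
nat n = cst (+ n)

0ₛ 1ₛ : Series
0ₛ = cst 0ℤ
1ₛ = cst 1ℤ

X : Series
X (suc zero) zero = 1ℤ
X _          _    = 0ℤ

Λ : Series
Λ zero (suc zero) = 1ℤ
Λ _    _          = 0ℤ

NonNeg : Series → Set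
NonNeg s = ∀ a b → 0ℤ ℤ.≤ s a b

Matrix : Set
Matrix = ℕ → ℕ → Series

_≈ₘ_ : Matrix → Matrix → Set
A ≈ₘ B = ∀ i j → A i j ≈ₛ B i j

_+ₘ_ : Matrix → Matrix → Matrix
(A +ₘ B) i j = A i j +ₛ B i j

_∙ₘ_ : Series → Matrix → Matrix
(c ∙ₘ A) i j = c *ₛ A i j

sumS : ℕ → (ℕ → Series) → Series
sumS zero    f = 0ₛ
sumS (suc n) f = sumS n f +ₛ f n

-- Product (A B)_{ij} = Σ_k A_{ik} B_{kj}, used only with A lower
-- triangular (A_{ik} = 0 for k > i), where the sum is over k ≤ i.
_·ₘ_ : Matrix → Matrix → Matrix
(A ·ₘ B) i j = sumS (suc i) (λ k → A i k *ₛ B k j)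

I : Matrix
I i j = if ⌊ j ≟ i ⌋ then 1ₛ else 0ₛ

Δ : Matrix
Δ i j = if ⌊ j ≟ suc i ⌋ then 1ₛ else 0ₛ

Ux : Matrix
Ux = Δ +ₘ (X ∙ₘ I)

L : Matrix
L n j = if ⌊ j ≟ n ⌋ then 1ₛ
        else if ⌊ suc j ≟ n ⌋ then nat n
        else 0ₛ

P : Matrix
P n j =
  if ⌊ j ≟ suc n ⌋ then 1ₛ
  else if ⌊ j ≟ n ⌋ then (nat (2 ℕ.* n) +ₛ Λ) +ₛ X
  else if ⌊ suc j ≟ n ⌋
    then (nat n *ₛ (nat (n ∸ 1) +ₛ Λ)) +ₛ (nat (2 ℕ.* n) *ₛ X)
  else if ⌊ suc (suc j) ≟ n ⌋ then (nat n *ₛ nat (n ∸ 1)) *ₛ X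
  else 0ₛ

sumFin : ∀ {k} → (Fin k → Series) → Series
sumFin {zero}  f = 0ₛ
sumFin {suc k} f = f zero +ₛ sumFin (λ j → f (suc j))

sign : ℕ → Series
sign zero          = 1ₛ
sign (suc zero)    = cst -1ℤ
sign (suc (suc n)) = sign n

det : ∀ {k} → (Fin k → Fin k → Series) → Series
det {zero}  M = 1ₛ
det {suc k} M =
  sumFin (λ j → (sign (toℕ j) *ₛ M zero j)
                 *ₛ det (λ r c → M (suc r) (punchIn j c)))

StrictlyIncreasing : ∀ {k} → (Fin k → ℕ) → Set
StrictlyIncreasing {k} f = ∀ (r s : Fin k) → r Fin.< s → f r ℕ.< f s

minor : ∀ {k} → Matrix → (Fin k → ℕ) → (Fin k → ℕ) → Series
minor A rows cols = det (λ r c → A (rows r) (cols c))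

TotallyPositive : Matrix → Set
TotallyPositive A =
  ∀ (k : ℕ) (rows cols : Fin k → ℕ) →
  StrictlyIncreasing rows → StrictlyIncreasing cols →
  NonNeg (minor A rows cols)

{-# OPTIONS --safe #-}
-- Part (a) is an identity between banded matrices, checked row by row after writing every entry
-- of a row in terms of Kronecker deltas.  For (b), multiplying a totally positive matrix by a
-- bidiagonal matrix with nonnegative entries keeps it totally positive: by linearity of the
-- determinant in each row, a minor of the product is a nonnegative combination of minors of the
-- factor and of determinants with two equal rows.  Now P = L T with T = L Uₓ + λ I, and T is the
-- odd-odd submatrix of a product of four bidiagonal matrices of twice the size (a planar network),
-- so T and then P are totally positive.
module Submission where

open import Algebra.Bundles using (CommutativeRing; RawRing)
open import Algebra.Structures using (IsAbelianGroup)
open import Algebra.Morphism.Structures using (IsRingMonomorphism)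
import Algebra.Construct.Pointwise as Pointwise
import Algebra.Morphism.RingMonomorphism as RingMonomorphism
open import Algebra.Properties.CommutativeSemigroup using (interchange)
open import Data.Bool using (Bool; true; false; if_then_else_)
open import Data.Fin as Fin using (Fin; zero; suc; toℕ; punchIn; punchOut; inject₁; lower₁)
import Data.Fin.Properties as Fin
open import Data.Integer as ℤ using (+_; 0ℤ; -1ℤ; +≤+)
import Data.Integer.Properties as ℤ
open import Data.Nat as ℕ using (ℕ; zero; suc; pred; _∸_; _<_; _≡ᵇ_; z≤n; s≤s)
import Data.Nat.Properties as ℕ
open import Data.Product using (_×_; _,_; ∃)
open import Data.Sum as Sum using (_⊎_; inj₁; inj₂; [_,_])
open import Data.Vec.Functional using (updateAt)
open import Data.Vec.Functional.Properties using (updateAt-updates; updateAt-minimal)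
open import Function using (_∘_; const; id)
open import Level using (0ℓ; _⊔_) renaming (suc to lsuc)
open import Relation.Binary.PropositionalEquality as ≡ using (_≡_; _≢_)
open import Relation.Binary.Definitions using (tri<; tri≈; tri>)
open import Relation.Nullary using (yes; no)
open import Relation.Nullary.Decidable using (⌊_⌋; isYes≗does; dec-false)
open import Relation.Nullary.Negation using (contradiction)

open import Defs
  using (Series; _≈ₛ_; sumℤ; _+ₛ_; -ₛ_; _*ₛ_; cst; nat; 0ₛ; 1ₛ; X; Λ; NonNeg; StrictlyIncreasing)

-- Finite sums and power series

module RangeSum {c ℓ} (R : CommutativeRing c ℓ) where

  open CommutativeRing R
  open import Relation.Binary.Reasoning.Setoid setoid

  ∑ : ℕ → (ℕ → Carrier) → Carrier
  ∑ zero    f = 0#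
  ∑ (suc n) f = ∑ n f + f n

  ∑-cong : ∀ n {f g} → (∀ i → i < n → f i ≈ g i) → ∑ n f ≈ ∑ n g
  ∑-cong zero    f≈g = refl
  ∑-cong (suc n) f≈g = +-cong (∑-cong n (λ i i<n → f≈g i (ℕ.m<n⇒m<1+n i<n))) (f≈g n (ℕ.n<1+n n))

  ∑-zero : ∀ n → ∑ n (const 0#) ≈ 0#
  ∑-zero zero    = refl
  ∑-zero (suc n) = trans (+-identityʳ _) (∑-zero n)

  ∑-distrib-+ : ∀ n f g → ∑ n (λ i → f i + g i) ≈ ∑ n f + ∑ n g
  ∑-distrib-+ zero    f g = sym (+-identityˡ 0#)
  ∑-distrib-+ (suc n) f g =
    trans (+-congʳ (∑-distrib-+ n f g)) (interchange +-commutativeSemigroup _ _ _ _)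

  *-distribˡ-∑ : ∀ n a f → a * ∑ n f ≈ ∑ n (λ i → a * f i)
  *-distribˡ-∑ zero    a f = zeroʳ a
  *-distribˡ-∑ (suc n) a f = trans (distribˡ a _ _) (+-congʳ (*-distribˡ-∑ n a f))

  *-distribʳ-∑ : ∀ n a f → ∑ n f * a ≈ ∑ n (λ i → f i * a)
  *-distribʳ-∑ zero    a f = zeroˡ a
  *-distribʳ-∑ (suc n) a f = trans (distribʳ a _ _) (+-congʳ (*-distribʳ-∑ n a f))

  ∑-head : ∀ n f → ∑ (suc n) f ≈ f 0 + ∑ n (f ∘ suc)
  ∑-head zero    f = trans (+-identityˡ _) (sym (+-identityʳ _))
  ∑-head (suc n) f = trans (+-congʳ (∑-head n f)) (+-assoc _ _ _)

  ∑-reverse : ∀ n f → ∑ (suc n) (λ i → f (n ∸ i)) ≈ ∑ (suc n) f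
  ∑-reverse zero    f = refl
  ∑-reverse (suc n) f = begin
    ∑ (suc n) (λ i → f (suc n ∸ i)) + f (n ∸ n)
      ≈⟨ +-cong (∑-cong (suc n) shift) (reflexive (≡.cong f (ℕ.n∸n≡0 n))) ⟩
    ∑ (suc n) (λ i → f (suc (n ∸ i))) + f 0  ≈⟨ +-congʳ (∑-reverse n (f ∘ suc)) ⟩
    ∑ (suc n) (f ∘ suc) + f 0                ≈⟨ +-comm _ _ ⟩
    f 0 + ∑ (suc n) (f ∘ suc)                ≈⟨ ∑-head (suc n) f ⟨
    ∑ (suc (suc n)) f                        ∎
    where
    shift : ∀ i → i < suc n → f (suc n ∸ i) ≈ f (suc (n ∸ i))
    shift i i<1+n = reflexive (≡.cong f (ℕ.+-∸-assoc 1 (ℕ.≤-pred i<1+n)))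

  ∑-triangle : ∀ n (F : ℕ → ℕ → Carrier) →
    ∑ (suc n) (λ i → ∑ (suc i) (λ j → F j i)) ≈ ∑ (suc n) (λ j → ∑ (suc (n ∸ j)) (λ k → F j (j ℕ.+ k)))
  ∑-triangle zero    F = refl
  ∑-triangle (suc n) F = begin
    ∑ (suc n) (λ i → ∑ (suc i) (λ j → F j i)) + (∑ (suc n) (λ j → F j (suc n)) + F (suc n) (suc n))
      ≈⟨ +-congʳ (∑-triangle n F) ⟩
    columns n + (∑ (suc n) (λ j → F j (suc n)) + F (suc n) (suc n))
      ≈⟨ +-assoc _ _ _ ⟨
    (columns n + ∑ (suc n) (λ j → F j (suc n))) + F (suc n) (suc n)
      ≈⟨ +-cong (trans (∑-cong (suc n) extend) (∑-distrib-+ (suc n) _ _)) corner ⟨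
    columns (suc n) ∎
    where
    columns : ℕ → Carrier
    columns m = ∑ (suc m) (λ j → ∑ (suc (m ∸ j)) (λ k → F j (j ℕ.+ k)))

    extend : ∀ j → j < suc n →
      ∑ (suc (suc n ∸ j)) (λ k → F j (j ℕ.+ k)) ≈ ∑ (suc (n ∸ j)) (λ k → F j (j ℕ.+ k)) + F j (suc n)
    extend j j<1+n rewrite ℕ.+-∸-assoc 1 (ℕ.≤-pred j<1+n) = +-congˡ (reflexive (≡.cong (F j)
      (≡.trans (ℕ.+-suc j (n ∸ j)) (≡.cong suc (ℕ.m+[n∸m]≡n (ℕ.≤-pred j<1+n))))))

    corner : ∑ (suc (n ∸ n)) (λ k → F (suc n) (suc n ℕ.+ k)) ≈ F (suc n) (suc n)
    corner rewrite ℕ.n∸n≡0 n | ℕ.+-identityʳ n = +-identityˡ _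

module PowerSeries {c ℓ} (R : CommutativeRing c ℓ) where

  open CommutativeRing R
  open RangeSum R
  open import Relation.Binary.Reasoning.Setoid setoid

  _≋_ : (ℕ → Carrier) → (ℕ → Carrier) → Set ℓ
  f ≋ g = ∀ n → f n ≈ g n

  _⊕_ : (ℕ → Carrier) → (ℕ → Carrier) → ℕ → Carrier
  (f ⊕ g) n = f n + g n

  _⋆_ : (ℕ → Carrier) → (ℕ → Carrier) → ℕ → Carrier
  (f ⋆ g) n = ∑ (suc n) (λ i → f i * g (n ∸ i))

  unit : ℕ → Carrier
  unit zero    = 1#
  unit (suc _) = 0#

  ⋆-cong : ∀ {f f′ g g′} → f ≋ f′ → g ≋ g′ → (f ⋆ g) ≋ (f′ ⋆ g′)
  ⋆-cong f≋f′ g≋g′ n = ∑-cong (suc n) (λ i _ → *-cong (f≋f′ i) (g≋g′ (n ∸ i)))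

  ⋆-comm : ∀ f g → (f ⋆ g) ≋ (g ⋆ f)
  ⋆-comm f g n = begin
    ∑ (suc n) (λ i → f i * g (n ∸ i))                ≈⟨ ∑-reverse n (λ i → f i * g (n ∸ i)) ⟨
    ∑ (suc n) (λ i → f (n ∸ i) * g (n ∸ (n ∸ i)))    ≈⟨ ∑-cong (suc n) swap ⟩
    ∑ (suc n) (λ i → g i * f (n ∸ i))                ∎
    where
    swap : ∀ i → i < suc n → f (n ∸ i) * g (n ∸ (n ∸ i)) ≈ g i * f (n ∸ i)
    swap i i<1+n = trans (*-comm _ _) (*-congʳ (reflexive (≡.cong g (ℕ.m∸[m∸n]≡n (ℕ.≤-pred i<1+n)))))

  ⋆-assoc : ∀ f g h → ((f ⋆ g) ⋆ h) ≋ (f ⋆ (g ⋆ h))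
  ⋆-assoc f g h n = begin
    ∑ (suc n) (λ i → ∑ (suc i) (λ j → f j * g (i ∸ j)) * h (n ∸ i))
      ≈⟨ ∑-cong (suc n) (λ i _ → *-distribʳ-∑ (suc i) _ _) ⟩
    ∑ (suc n) (λ i → ∑ (suc i) (λ j → (f j * g (i ∸ j)) * h (n ∸ i)))
      ≈⟨ ∑-triangle n (λ j i → (f j * g (i ∸ j)) * h (n ∸ i)) ⟩
    ∑ (suc n) (λ j → ∑ (suc (n ∸ j)) (λ k → (f j * g ((j ℕ.+ k) ∸ j)) * h (n ∸ (j ℕ.+ k))))
      ≈⟨ ∑-cong (suc n) (λ j _ → ∑-cong (suc (n ∸ j)) (λ k _ → reindex j k)) ⟩
    ∑ (suc n) (λ j → ∑ (suc (n ∸ j)) (λ k → f j * (g k * h ((n ∸ j) ∸ k))))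
      ≈⟨ ∑-cong (suc n) (λ j _ → *-distribˡ-∑ (suc (n ∸ j)) _ _) ⟨
    ∑ (suc n) (λ j → f j * ∑ (suc (n ∸ j)) (λ k → g k * h ((n ∸ j) ∸ k))) ∎
    where
    reindex : ∀ j k → (f j * g ((j ℕ.+ k) ∸ j)) * h (n ∸ (j ℕ.+ k)) ≈ f j * (g k * h ((n ∸ j) ∸ k))
    reindex j k = trans (*-assoc _ _ _) (*-congˡ (*-cong (reflexive (≡.cong g (ℕ.m+n∸m≡n j k)))
                                                          (reflexive (≡.cong h (≡.sym (ℕ.∸-+-assoc n j k))))))

  ⋆-identityˡ : ∀ f → (unit ⋆ f) ≋ f
  ⋆-identityˡ f n = begin
    ∑ (suc n) (λ i → unit i * f (n ∸ i))       ≈⟨ ∑-head n _ ⟩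
    1# * f n + ∑ n (λ i → 0# * f (n ∸ suc i))
      ≈⟨ +-cong (*-identityˡ _) (trans (∑-cong n (λ i _ → zeroˡ _)) (∑-zero n)) ⟩
    f n + 0#                                   ≈⟨ +-identityʳ _ ⟩
    f n                                        ∎

  ⋆-distribˡ : ∀ f g h → (f ⋆ (g ⊕ h)) ≋ ((f ⋆ g) ⊕ (f ⋆ h))
  ⋆-distribˡ f g h n = trans (∑-cong (suc n) (λ i _ → distribˡ _ _ _)) (∑-distrib-+ (suc n) _ _)

  ⊕-isAbelianGroup : IsAbelianGroup _≋_ _⊕_ (const 0#) (λ f n → - f n)
  ⊕-isAbelianGroup = Pointwise.isAbelianGroup ℕ +-isAbelianGroup

  open import Algebra.Consequences.Setoid (IsAbelianGroup.setoid ⊕-isAbelianGroup)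
    using (comm∧idˡ⇒id; comm∧distrˡ⇒distr)

  powerSeriesRing : CommutativeRing c ℓ
  powerSeriesRing = record
    { isCommutativeRing = record
      { isRing = record
        { +-isAbelianGroup = ⊕-isAbelianGroup
        ; *-cong           = ⋆-cong
        ; *-assoc          = ⋆-assoc
        ; *-identity       = comm∧idˡ⇒id ⋆-comm ⋆-identityˡ
        ; distrib          = comm∧distrˡ⇒distr (IsAbelianGroup.∙-cong ⊕-isAbelianGroup) ⋆-comm ⋆-distribˡ
        }
      ; *-comm = ⋆-comm
      }
    }

-- ℤ[[λ]] and ℤ[[λ]][[x]]; a series s of Defs is the element a ↦ (b ↦ s a b) of the latter.
module ℤSum = RangeSum ℤ.+-*-commutativeRing
module Coefficients = PowerSeries ℤ.+-*-commutativeRing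
module Bivariate = PowerSeries Coefficients.powerSeriesRing

sumℤ≡∑ : ∀ n f → sumℤ n f ≡ ℤSum.∑ n f
sumℤ≡∑ zero    f = ≡.refl
sumℤ≡∑ (suc n) f = ≡.cong (ℤ._+ f n) (sumℤ≡∑ n f)

∑-pointwise : ∀ n F b → RangeSum.∑ Coefficients.powerSeriesRing n F b ≡ sumℤ n (λ i → F i b)
∑-pointwise zero    F b = ≡.refl
∑-pointwise (suc n) F b = ≡.cong (ℤ._+ F n b) (∑-pointwise n F b)

*ₛ-isCauchyProduct : ∀ s t → (s *ₛ t) ≈ₛ Bivariate._⋆_ s t
*ₛ-isCauchyProduct s t a b = begin
  sumℤ (suc a) (λ i → sumℤ (suc b) (λ j → s i j ℤ.* t (a ∸ i) (b ∸ j)))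
    ≡⟨ sumℤ≡∑ (suc a) _ ⟩
  ℤSum.∑ (suc a) (λ i → sumℤ (suc b) (λ j → s i j ℤ.* t (a ∸ i) (b ∸ j)))
    ≡⟨ ℤSum.∑-cong (suc a) (λ i _ → sumℤ≡∑ (suc b) _) ⟩
  ℤSum.∑ (suc a) (λ i → Coefficients._⋆_ (s i) (t (a ∸ i)) b)
    ≡⟨ sumℤ≡∑ (suc a) _ ⟨
  sumℤ (suc a) (λ i → Coefficients._⋆_ (s i) (t (a ∸ i)) b)
    ≡⟨ ∑-pointwise (suc a) _ b ⟨
  Bivariate._⋆_ s t a b ∎
  where open ≡.≡-Reasoning

0ₛ≈0 : 0ₛ ≈ₛ const (const 0ℤ)
0ₛ≈0 zero    zero    = ≡.refl
0ₛ≈0 zero    (suc b) = ≡.refl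
0ₛ≈0 (suc a) b       = ≡.refl

1ₛ≈unit : 1ₛ ≈ₛ Bivariate.unit
1ₛ≈unit zero    zero    = ≡.refl
1ₛ≈unit zero    (suc b) = ≡.refl
1ₛ≈unit (suc a) b       = ≡.refl

seriesRawRing : RawRing 0ℓ 0ℓ
seriesRawRing = record
  { Carrier = Series ; _≈_ = _≈ₛ_ ; _+_ = _+ₛ_ ; _*_ = _*ₛ_ ; -_ = -ₛ_ ; 0# = 0ₛ ; 1# = 1ₛ }

series↪powerSeries : IsRingMonomorphism seriesRawRing (CommutativeRing.rawRing Bivariate.powerSeriesRing) id
series↪powerSeries = record
  { isRingHomomorphism = record
    { isSemiringHomomorphism = record
      { isNearSemiringHomomorphism = record
        { +-isMonoidHomomorphism = record
          { isMagmaHomomorphism = record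
            { isRelHomomorphism = record { cong = id }
            ; homo = λ _ _ _ _ → ≡.refl
            }
          ; ε-homo = 0ₛ≈0
          }
        ; *-homo = *ₛ-isCauchyProduct
        }
      ; 1#-homo = 1ₛ≈unit
      }
    ; -‿homo = λ _ _ _ → ≡.refl
    }
  ; injective = id
  }

seriesRing : CommutativeRing 0ℓ 0ℓ
seriesRing = record
  { isCommutativeRing = RingMonomorphism.isCommutativeRing series↪powerSeries
                          (CommutativeRing.isCommutativeRing Bivariate.powerSeriesRing)
  }

-- Determinants

punchIn-punchOut-comm : ∀ {n} {p q : Fin (suc (suc n))} (p≢q : p ≢ q) (q≢p : q ≢ p) (c : Fin n) →
  punchIn p (punchIn (punchOut p≢q) c) ≡ punchIn q (punchIn (punchOut q≢p) c)
punchIn-punchOut-comm {p = zero}  {zero}  p≢q q≢p c = contradiction ≡.refl p≢q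
punchIn-punchOut-comm {p = zero}  {suc q} p≢q q≢p c = ≡.refl
punchIn-punchOut-comm {p = suc p} {zero}  p≢q q≢p c = ≡.refl
punchIn-punchOut-comm {suc n} {suc p} {suc q} p≢q q≢p zero    = ≡.refl
punchIn-punchOut-comm {suc n} {suc p} {suc q} p≢q q≢p (suc c) =
  ≡.cong suc (punchIn-punchOut-comm (p≢q ∘ ≡.cong suc) (q≢p ∘ ≡.cong suc) c)

module Determinant {c ℓ} (R : CommutativeRing c ℓ) where

  open CommutativeRing R hiding (zero)
  open import Algebra.Properties.Ring ring using (-‿involutive; -‿distribˡ-*; -‿distribʳ-*)
  open import Algebra.Properties.CommutativeMonoid.Sum +-commutativeMonoid
    using (sum; sum-cong-≋; sum-replicate-zero; sum-remove; ∑-distrib-+)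
  open import Algebra.Properties.Semiring.Sum semiring using (*-distribˡ-sum)
  open import Algebra.Solver.Ring.NaturalCoefficients.Default commutativeSemiring
    using (solve; _:=_; _:+_; _:*_; con)
  open import Relation.Binary.Reasoning.Setoid setoid

  SquareMatrix : ℕ → Set c
  SquareMatrix k = Fin k → Fin k → Carrier

  sign : ℕ → Carrier
  sign zero          = 1#
  sign (suc zero)    = - 1#
  sign (suc (suc n)) = sign n

  minor₀ : ∀ {k} → SquareMatrix (suc k) → Fin (suc k) → SquareMatrix k
  minor₀ M j r c = M (suc r) (punchIn j c)

  det : ∀ {k} → SquareMatrix k → Carrier
  laplaceTerm : ∀ {k} → SquareMatrix (suc k) → Fin (suc k) → Carrier

  det {zero}  M = 1#
  det {suc k} M = sum (laplaceTerm M)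

  laplaceTerm M j = (sign (toℕ j) * M zero j) * det (minor₀ M j)

  sum-zero : ∀ {k} {f : Fin k → Carrier} → (∀ j → f j ≈ 0#) → sum f ≈ 0#
  sum-zero {k} f≈0 = trans (sum-cong-≋ f≈0) (sum-replicate-zero k)

  sum-linear : ∀ {k} {f g h : Fin k → Carrier} (d l : Carrier) →
    (∀ j → f j ≈ d * g j + l * h j) → sum f ≈ d * sum g + l * sum h
  sum-linear {f = f} {g} {h} d l f≈ = begin
    sum f                                     ≈⟨ sum-cong-≋ f≈ ⟩
    sum (λ j → d * g j + l * h j)             ≈⟨ ∑-distrib-+ (λ j → d * g j) (λ j → l * h j) ⟩
    sum (λ j → d * g j) + sum (λ j → l * h j) ≈⟨ +-cong (*-distribˡ-sum d g) (*-distribˡ-sum l h) ⟨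
    d * sum g + l * sum h                     ∎

  det-cong : ∀ {k} {M N : SquareMatrix k} → (∀ r c → M r c ≈ N r c) → det M ≈ det N
  det-cong {zero}  M≈N = refl
  det-cong {suc k} M≈N = sum-cong-≋ {suc k} λ j →
    *-cong (*-congˡ {sign (toℕ j)} (M≈N zero j)) (det-cong (λ r c → M≈N (suc r) (punchIn j c)))

  laplaceTerm-entry≈0 : ∀ {k} (M : SquareMatrix (suc k)) j → M zero j ≈ 0# → laplaceTerm M j ≈ 0#
  laplaceTerm-entry≈0 M j M₀ⱼ≈0 = trans (*-congʳ (trans (*-congˡ M₀ⱼ≈0) (zeroʳ _))) (zeroˡ _)

  laplaceTerm-minor≈0 : ∀ {k} (M : SquareMatrix (suc k)) j → det (minor₀ M j) ≈ 0# → laplaceTerm M j ≈ 0#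
  laplaceTerm-minor≈0 M j minor≈0 = trans (*-congˡ minor≈0) (zeroʳ _)

  det-linear : ∀ {k} (t : Fin k) {M A B : SquareMatrix k} (d l : Carrier) →
    (∀ r → r ≢ t → ∀ c → M r c ≈ A r c) → (∀ r → r ≢ t → ∀ c → M r c ≈ B r c) →
    (∀ c → M t c ≈ d * A t c + l * B t c) → det M ≈ d * det A + l * det B
  det-linear zero {M} {A} {B} d l M≈A M≈B Mₜ≈ = sum-linear d l λ j → begin
    (sign (toℕ j) * M zero j) * det (minor₀ M j)
      ≈⟨ *-congʳ (*-congˡ (Mₜ≈ j)) ⟩
    (sign (toℕ j) * (d * A zero j + l * B zero j)) * det (minor₀ M j)
      ≈⟨ distribute (sign (toℕ j)) (A zero j) (B zero j) (det (minor₀ M j)) d l ⟩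
    d * ((sign (toℕ j) * A zero j) * det (minor₀ M j)) + l * ((sign (toℕ j) * B zero j) * det (minor₀ M j))
      ≈⟨ +-cong (*-congˡ (*-congˡ (det-cong (λ r → M≈A (suc r) (λ ()) ∘ punchIn j))))
                (*-congˡ (*-congˡ (det-cong (λ r → M≈B (suc r) (λ ()) ∘ punchIn j)))) ⟩
    d * laplaceTerm A j + l * laplaceTerm B j ∎
    where
    distribute : ∀ s a b m d l → (s * (d * a + l * b)) * m ≈ d * ((s * a) * m) + l * ((s * b) * m)
    distribute = solve 6 (λ s a b m d l → (s :* (d :* a :+ l :* b)) :* m
                                          := d :* ((s :* a) :* m) :+ l :* ((s :* b) :* m)) refl
  det-linear (suc t) {M} {A} {B} d l M≈A M≈B Mₜ≈ = sum-linear d l λ j → begin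
    (sign (toℕ j) * M zero j) * det (minor₀ M j)
      ≈⟨ *-congˡ (det-linear t d l (λ r r≢t → M≈A (suc r) (r≢t ∘ Fin.suc-injective) ∘ punchIn j)
                                   (λ r r≢t → M≈B (suc r) (r≢t ∘ Fin.suc-injective) ∘ punchIn j)
                                   (Mₜ≈ ∘ punchIn j)) ⟩
    (sign (toℕ j) * M zero j) * (d * det (minor₀ A j) + l * det (minor₀ B j))
      ≈⟨ distribute (sign (toℕ j) * M zero j) (det (minor₀ A j)) (det (minor₀ B j)) d l ⟩
    d * ((sign (toℕ j) * M zero j) * det (minor₀ A j)) + l * ((sign (toℕ j) * M zero j) * det (minor₀ B j))
      ≈⟨ +-cong (*-congˡ (*-congʳ (*-congˡ (M≈A zero (λ ()) j))))
                (*-congˡ (*-congʳ (*-congˡ (M≈B zero (λ ()) j)))) ⟩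
    d * laplaceTerm A j + l * laplaceTerm B j ∎
    where
    distribute : ∀ x a b d l → x * (d * a + l * b) ≈ d * (x * a) + l * (x * b)
    distribute = solve 5 (λ x a b d l → x :* (d :* a :+ l :* b) := d :* (x :* a) :+ l :* (x :* b)) refl

  det-zeroColumn : ∀ {k} (M : SquareMatrix k) (c₀ : Fin k) → (∀ r → M r c₀ ≈ 0#) → det M ≈ 0#
  det-zeroColumn {suc k} M c₀ column≈0 = sum-zero term≈0
    where
    term≈0 : ∀ j → laplaceTerm M j ≈ 0#
    term≈0 j with j Fin.≟ c₀
    ... | yes ≡.refl = laplaceTerm-entry≈0 M j (column≈0 zero)
    ... | no j≢c₀    = laplaceTerm-minor≈0 M j (det-zeroColumn (minor₀ M j) (punchOut j≢c₀) λ r →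
                         trans (reflexive (≡.cong (M (suc r)) (Fin.punchIn-punchOut j≢c₀))) (column≈0 (suc r)))

  sign-suc : ∀ n → sign (suc n) ≈ - sign n
  sign-suc zero    = refl
  sign-suc (suc n) = sym (trans (-‿cong (sign-suc n)) (-‿involutive (sign n)))

  -x*-y≈x*y : ∀ x y → - x * - y ≈ x * y
  -x*-y≈x*y x y = begin
    - x * - y      ≈⟨ -‿distribˡ-* x (- y) ⟨
    - (x * - y)    ≈⟨ -‿cong (-‿distribʳ-* x y) ⟨
    - - (x * y)    ≈⟨ -‿involutive (x * y) ⟩
    x * y          ∎

  sign-punchOut : ∀ {n} {p q : Fin (suc (suc n))} (p≢q : p ≢ q) (q≢p : q ≢ p) →
    sign (toℕ p) * sign (toℕ (punchOut p≢q)) + sign (toℕ q) * sign (toℕ (punchOut q≢p)) ≈ 0#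
  sign-punchOut {p = zero} {zero} p≢q q≢p = contradiction ≡.refl p≢q
  sign-punchOut {p = zero} {suc q} p≢q q≢p = begin
    1# * sign (toℕ q) + sign (suc (toℕ q)) * 1#
      ≈⟨ +-cong (*-identityˡ _) (trans (*-identityʳ _) (sign-suc (toℕ q))) ⟩
    sign (toℕ q) + - sign (toℕ q)  ≈⟨ -‿inverseʳ _ ⟩
    0#                             ∎
  sign-punchOut {p = suc p} {zero} p≢q q≢p = begin
    sign (suc (toℕ p)) * 1# + 1# * sign (toℕ p)
      ≈⟨ +-cong (trans (*-identityʳ _) (sign-suc (toℕ p))) (*-identityˡ _) ⟩
    - sign (toℕ p) + sign (toℕ p)  ≈⟨ -‿inverseˡ _ ⟩
    0#                             ∎
  sign-punchOut {zero} {suc zero} {suc zero} p≢q q≢p = contradiction ≡.refl p≢q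
  sign-punchOut {suc n} {suc p} {suc q} p≢q q≢p = begin
    sign (suc (toℕ p)) * sign (suc (toℕ p′)) + sign (suc (toℕ q)) * sign (suc (toℕ q′))
      ≈⟨ +-cong (trans (*-cong (sign-suc (toℕ p)) (sign-suc (toℕ p′))) (-x*-y≈x*y _ _))
                (trans (*-cong (sign-suc (toℕ q)) (sign-suc (toℕ q′))) (-x*-y≈x*y _ _)) ⟩
    sign (toℕ p) * sign (toℕ p′) + sign (toℕ q) * sign (toℕ q′)
      ≈⟨ sign-punchOut (p≢q ∘ ≡.cong suc) (q≢p ∘ ≡.cong suc) ⟩
    0# ∎
    where
    p′ q′ : Fin (suc n)
    p′ = punchOut (p≢q ∘ ≡.cong suc)
    q′ = punchOut (q≢p ∘ ≡.cong suc)

  sum-antisymmetric : ∀ {k} (h : Fin k → Fin k → Carrier) →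
    (∀ p → h p p ≈ 0#) → (∀ p q → h p q + h q p ≈ 0#) → sum (λ p → sum (h p)) ≈ 0#
  sum-antisymmetric {zero}  h diagonal antisym = refl
  sum-antisymmetric {suc k} h diagonal antisym = begin
    (h zero zero + sum (h zero ∘ suc)) + sum (λ p → h (suc p) zero + sum (h (suc p) ∘ suc))
      ≈⟨ +-cong (+-congʳ (diagonal zero)) (∑-distrib-+ (λ p → h (suc p) zero) (λ p → sum (h (suc p) ∘ suc))) ⟩
    (0# + sum (h zero ∘ suc)) + (sum (λ p → h (suc p) zero) + sum (λ p → sum (h (suc p) ∘ suc)))
      ≈⟨ regroup _ _ _ ⟩
    (sum (h zero ∘ suc) + sum (λ p → h (suc p) zero)) + sum (λ p → sum (h (suc p) ∘ suc))
      ≈⟨ +-cong (trans (sym (∑-distrib-+ (h zero ∘ suc) (λ p → h (suc p) zero))) (sum-zero (antisym zero ∘ suc)))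
                (sum-antisymmetric (λ p q → h (suc p) (suc q)) (diagonal ∘ suc) (λ p q → antisym (suc p) (suc q))) ⟩
    0# + 0#
      ≈⟨ +-identityˡ 0# ⟩
    0# ∎
    where
    regroup : ∀ a b c → (0# + a) + (b + c) ≈ (a + b) + c
    regroup = solve 3 (λ a b c → (con 0 :+ a) :+ (b :+ c) := (a :+ b) :+ c) refl

  -- Expanding along the first two rows writes det M as a double sum over ordered pairs of
  -- columns whose terms are antisymmetric in the pair.
  module EqualFirstRows {k} (M : SquareMatrix (suc (suc k))) (rows≈ : ∀ c → M zero c ≈ M (suc zero) c) where

    minor₀₁ : (p q : Fin (suc (suc k))) → p ≢ q → Carrier
    minor₀₁ p q p≢q = det (λ r c → M (suc (suc r)) (punchIn p (punchIn (punchOut p≢q) c)))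

    pairTerm : Fin (suc (suc k)) → Fin (suc (suc k)) → Carrier
    pairTerm p q with p Fin.≟ q
    ... | yes _  = 0#
    ... | no p≢q = (sign (toℕ p) * sign (toℕ (punchOut p≢q))) * ((M zero p * M zero q) * minor₀₁ p q p≢q)

    pairTerm-diagonal : ∀ p → pairTerm p p ≈ 0#
    pairTerm-diagonal p with p Fin.≟ p
    ... | yes _  = refl
    ... | no p≢p = contradiction ≡.refl p≢p

    pairTerm-punchIn : ∀ p q → (sign (toℕ p) * M zero p) * laplaceTerm (minor₀ M p) q ≈ pairTerm p (punchIn p q)
    pairTerm-punchIn p q with p Fin.≟ punchIn p q
    ... | yes p≡ = contradiction (≡.sym p≡) (Fin.punchInᵢ≢i p q)
    ... | no p≢q rewrite ≡.trans (Fin.punchOut-cong p {i≢j = p≢q} ≡.refl) (Fin.punchOut-punchIn p {q}) = begin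
      (sign (toℕ p) * M zero p) * ((sign (toℕ q) * M (suc zero) (punchIn p q)) * D)
        ≈⟨ *-congˡ (*-congʳ (*-congˡ (sym (rows≈ (punchIn p q))))) ⟩
      (sign (toℕ p) * M zero p) * ((sign (toℕ q) * M zero (punchIn p q)) * D)
        ≈⟨ regroup (sign (toℕ p)) (M zero p) (sign (toℕ q)) (M zero (punchIn p q)) D ⟩
      (sign (toℕ p) * sign (toℕ q)) * ((M zero p * M zero (punchIn p q)) * D) ∎
      where
      D : Carrier
      D = det (minor₀ (minor₀ M p) q)
      regroup : ∀ s a s′ b d → (s * a) * ((s′ * b) * d) ≈ (s * s′) * ((a * b) * d)
      regroup = solve 5 (λ s a s′ b d → (s :* a) :* ((s′ :* b) :* d) := (s :* s′) :* ((a :* b) :* d)) refl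

    pairTerm-antisym : ∀ p q → pairTerm p q + pairTerm q p ≈ 0#
    pairTerm-antisym p q with p Fin.≟ q | q Fin.≟ p
    ... | yes _      | yes _      = +-identityˡ 0#
    ... | yes ≡.refl | no q≢p     = contradiction ≡.refl q≢p
    ... | no p≢q     | yes ≡.refl = contradiction ≡.refl p≢q
    ... | no p≢q     | no q≢p     = begin
      σ p q p≢q * Y + σ q p q≢p * ((M zero q * M zero p) * minor₀₁ q p q≢p)
        ≈⟨ +-congˡ (*-congˡ (*-cong (*-comm _ _) (det-cong λ r c →
             reflexive (≡.cong (M (suc (suc r))) (punchIn-punchOut-comm q≢p p≢q c))))) ⟩
      σ p q p≢q * Y + σ q p q≢p * Y    ≈⟨ distribʳ Y _ _ ⟨
      (σ p q p≢q + σ q p q≢p) * Y      ≈⟨ *-congʳ (sign-punchOut p≢q q≢p) ⟩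
      0# * Y                           ≈⟨ zeroˡ Y ⟩
      0#                               ∎
      where
      σ : (p q : Fin (suc (suc k))) → p ≢ q → Carrier
      σ p q p≢q = sign (toℕ p) * sign (toℕ (punchOut p≢q))
      Y : Carrier
      Y = (M zero p * M zero q) * minor₀₁ p q p≢q

    det≈pairSum : det M ≈ sum (λ p → sum (pairTerm p))
    det≈pairSum = sum-cong-≋ λ p → begin
      (sign (toℕ p) * M zero p) * det (minor₀ M p)
        ≈⟨ *-distribˡ-sum _ (laplaceTerm (minor₀ M p)) ⟩
      sum (λ q → (sign (toℕ p) * M zero p) * laplaceTerm (minor₀ M p) q)
        ≈⟨ sum-cong-≋ (pairTerm-punchIn p) ⟩
      sum (pairTerm p ∘ punchIn p)                 ≈⟨ +-identityˡ _ ⟨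
      0# + sum (pairTerm p ∘ punchIn p)            ≈⟨ +-congʳ (pairTerm-diagonal p) ⟨
      pairTerm p p + sum (pairTerm p ∘ punchIn p)  ≈⟨ sum-remove (pairTerm p) ⟨
      sum (pairTerm p)                             ∎

  det-equalFirstRows : ∀ {k} (M : SquareMatrix (suc (suc k))) → (∀ c → M zero c ≈ M (suc zero) c) → det M ≈ 0#
  det-equalFirstRows M rows≈ = trans det≈pairSum (sum-antisymmetric pairTerm pairTerm-diagonal pairTerm-antisym)
    where open EqualFirstRows M rows≈

  det-equalAdjacentRows : ∀ {k} (M : SquareMatrix (suc k)) (t : Fin k) →
    (∀ c → M (inject₁ t) c ≈ M (suc t) c) → det M ≈ 0#
  det-equalAdjacentRows M zero    rows≈ = det-equalFirstRows M rows≈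
  det-equalAdjacentRows M (suc t) rows≈ = sum-zero λ j →
    laplaceTerm-minor≈0 M j (det-equalAdjacentRows (minor₀ M j) t (rows≈ ∘ punchIn j))

_[_]≔_ : ∀ {k} → (Fin k → ℕ) → Fin k → ℕ → Fin k → ℕ
rows [ t ]≔ m = updateAt rows t (const m)

HasAdjacentRepeat : ∀ {k} → (Fin (suc k) → ℕ) → Set
HasAdjacentRepeat {k} rows = ∃ λ (t : Fin k) → rows (inject₁ t) ≡ rows (suc t)

module _ {k} {rows : Fin k → ℕ} (rows↑ : StrictlyIncreasing rows) where

  increasing-mono-≤ : ∀ {r s} → toℕ r ℕ.≤ toℕ s → rows r ℕ.≤ rows s
  increasing-mono-≤ {r} {s} r≤s with toℕ r ℕ.≟ toℕ s
  ... | yes r≡s = ℕ.≤-reflexive (≡.cong rows (Fin.toℕ-injective r≡s))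
  ... | no  r≢s = ℕ.<⇒≤ (rows↑ r s (ℕ.≤∧≢⇒< r≤s r≢s))

  increasing-injective : ∀ {r s} → rows r ≡ rows s → r ≡ s
  increasing-injective {r} {s} eq with Fin.<-cmp r s
  ... | tri< r<s _ _ = contradiction eq (ℕ.<⇒≢ (rows↑ r s r<s))
  ... | tri≈ _ r≡s _ = r≡s
  ... | tri> _ _ s<r = contradiction (≡.sym eq) (ℕ.<⇒≢ (rows↑ s r s<r))

  updateAt-increasing : ∀ {t m} → (∀ r → r Fin.< t → rows r ℕ.< m) → (∀ s → t Fin.< s → m ℕ.< rows s) →
    StrictlyIncreasing (rows [ t ]≔ m)
  updateAt-increasing {t} {m} below above r s r<s with r Fin.≟ t | s Fin.≟ t
  ... | yes ≡.refl | yes ≡.refl = contradiction r<s (ℕ.<-irrefl ≡.refl)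
  ... | yes ≡.refl | no s≢t = ≡.subst₂ ℕ._<_ (≡.sym (updateAt-updates r rows))
                                              (≡.sym (updateAt-minimal s r rows s≢t)) (above s r<s)
  ... | no r≢t | yes ≡.refl = ≡.subst₂ ℕ._<_ (≡.sym (updateAt-minimal r s rows r≢t))
                                              (≡.sym (updateAt-updates s rows)) (below r r<s)
  ... | no r≢t | no s≢t = ≡.subst₂ ℕ._<_ (≡.sym (updateAt-minimal r t rows r≢t))
                                           (≡.sym (updateAt-minimal s t rows s≢t)) (rows↑ r s r<s)

inject₁≢suc : ∀ {k} (u : Fin k) → inject₁ u ≢ suc u
inject₁≢suc u eq = ℕ.1+n≢n (≡.sym (≡.trans (≡.sym (Fin.toℕ-inject₁ u)) (≡.cong toℕ eq)))

inject₁<suc : ∀ {k} (u : Fin k) → inject₁ u Fin.< suc u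
inject₁<suc u = ℕ.s≤s (ℕ.≤-reflexive (Fin.toℕ-inject₁ u))

IncreasingUpToRepeat : ∀ {k} → (Fin (suc k) → ℕ) → Set
IncreasingUpToRepeat rows = StrictlyIncreasing rows ⊎ HasAdjacentRepeat rows

replace-by-pred : ∀ {k} {rows : Fin (suc k) → ℕ} {t n} → StrictlyIncreasing rows → rows t ≡ n →
  IncreasingUpToRepeat (rows [ t ]≔ pred n)
replace-by-pred {t = zero} rows↑ ≡.refl = inj₁ (updateAt-increasing rows↑ (λ _ ()) λ s 0<s →
  ℕ.≤-<-trans ℕ.pred[n]≤n (rows↑ zero s 0<s))
replace-by-pred {rows = rows} {suc u} {n} rows↑ ≡.refl with rows (inject₁ u) ℕ.≟ pred n
... | yes repeat = inj₂ (u , ≡.trans (updateAt-minimal (inject₁ u) (suc u) rows (inject₁≢suc u))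
                                     (≡.trans repeat (≡.sym (updateAt-updates (suc u) rows))))
... | no ¬repeat = inj₁ (updateAt-increasing rows↑ below above)
  where
  below : ∀ r → r Fin.< suc u → rows r ℕ.< pred n
  below r (s≤s r≤u) =
    ℕ.≤-<-trans (increasing-mono-≤ rows↑ (ℕ.≤-trans r≤u (ℕ.≤-reflexive (≡.sym (Fin.toℕ-inject₁ u)))))
                (ℕ.≤∧≢⇒< (ℕ.<⇒≤pred (rows↑ (inject₁ u) (suc u) (inject₁<suc u))) ¬repeat)
  above : ∀ s → suc u Fin.< s → pred n ℕ.< rows s
  above s t<s = ℕ.≤-<-trans ℕ.pred[n]≤n (rows↑ (suc u) s t<s)

lastOrInject₁ : ∀ {k} (t : Fin (suc k)) → toℕ t ≡ k ⊎ ∃ λ u → t ≡ inject₁ u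
lastOrInject₁ {k} t with k ℕ.≟ toℕ t
... | yes k≡t = inj₁ (≡.sym k≡t)
... | no  k≢t = inj₂ (lower₁ t k≢t , ≡.sym (Fin.inject₁-lower₁ t k≢t))

replace-by-suc : ∀ {k} {rows : Fin (suc k) → ℕ} {t n} → StrictlyIncreasing rows → rows t ≡ n →
  IncreasingUpToRepeat (rows [ t ]≔ suc n)
replace-by-suc {k} {rows} {t} {n} rows↑ rowₜ≡n with lastOrInject₁ t
... | inj₁ t≡k = inj₁ (updateAt-increasing rows↑ below λ s t<s → contradiction
  (ℕ.<-≤-trans t<s (ℕ.≤-trans (Fin.toℕ≤pred[n] s) (ℕ.≤-reflexive (≡.sym t≡k)))) (ℕ.<-irrefl ≡.refl))
  where
  below : ∀ r → r Fin.< t → rows r ℕ.< suc n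
  below r r<t = ℕ.m<n⇒m<1+n (≡.subst (rows r ℕ.<_) rowₜ≡n (rows↑ r t r<t))
... | inj₂ (u , ≡.refl) with rows (suc u) ℕ.≟ suc n
...   | yes repeat = inj₂ (u , ≡.trans (updateAt-updates (inject₁ u) rows) (≡.trans (≡.sym repeat)
                                 (≡.sym (updateAt-minimal (suc u) (inject₁ u) rows (inject₁≢suc u ∘ ≡.sym)))))
...   | no ¬repeat = inj₁ (updateAt-increasing rows↑ below above)
  where
  below : ∀ r → r Fin.< inject₁ u → rows r ℕ.< suc n
  below r r<t = ℕ.m<n⇒m<1+n (≡.subst (rows r ℕ.<_) rowₜ≡n (rows↑ r (inject₁ u) r<t))
  above : ∀ s → inject₁ u Fin.< s → suc n ℕ.< rows s
  above s t<s = ℕ.<-≤-trans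
    (ℕ.≤∧≢⇒< (≡.subst (ℕ._< rows (suc u)) rowₜ≡n (rows↑ (inject₁ u) (suc u) (inject₁<suc u)))
             (¬repeat ∘ ≡.sym))
    (increasing-mono-≤ rows↑ (≡.subst (ℕ._< toℕ s) (Fin.toℕ-inject₁ u) t<s))

bound : ∀ {k} → (Fin k → ℕ) → ℕ
bound {zero}  rows = 0
bound {suc k} rows = suc (rows zero) ℕ.⊔ bound (rows ∘ suc)

<-bound : ∀ {k} (rows : Fin k → ℕ) r → rows r ℕ.< bound rows
<-bound rows zero    = ℕ.m≤m⊔n (suc (rows zero)) (bound (rows ∘ suc))
<-bound rows (suc r) = ℕ.<-≤-trans (<-bound (rows ∘ suc) r) (ℕ.m≤n⊔m _ _)

-- Total positivity

record NonnegativeCone {c ℓ} (R : CommutativeRing c ℓ) p : Set (c ⊔ ℓ ⊔ lsuc p) where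
  open CommutativeRing R
  field
    Nonneg      : Carrier → Set p
    Nonneg-resp : ∀ {x y} → x ≈ y → Nonneg x → Nonneg y
    Nonneg-0#   : Nonneg 0#
    Nonneg-1#   : Nonneg 1#
    Nonneg-+    : ∀ {x y} → Nonneg x → Nonneg y → Nonneg (x + y)
    Nonneg-*    : ∀ {x y} → Nonneg x → Nonneg y → Nonneg (x * y)

double : ℕ → ℕ
double zero    = zero
double (suc i) = suc (suc (double i))

odd : ℕ → ℕ
odd = suc ∘ double

odd-mono : ∀ {i j} → i ℕ.< j → odd i ℕ.< odd j
odd-mono {zero}  {suc j} _         = s≤s (s≤s z≤n)
odd-mono {suc i} {suc j} (s≤s i<j) = s≤s (s≤s (odd-mono i<j))

double-≡ᵇ : ∀ m n → (double m ≡ᵇ double n) ≡ (m ≡ᵇ n)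
double-≡ᵇ zero    zero    = ≡.refl
double-≡ᵇ zero    (suc n) = ≡.refl
double-≡ᵇ (suc m) zero    = ≡.refl
double-≡ᵇ (suc m) (suc n) = double-≡ᵇ m n

interleave : ∀ {a} {A : Set a} → (ℕ → A) → (ℕ → A) → ℕ → A
interleave e o zero          = e 0
interleave e o (suc zero)    = o 0
interleave e o (suc (suc n)) = interleave (e ∘ suc) (o ∘ suc) n

interleave-even : ∀ {a} {A : Set a} (e o : ℕ → A) i → interleave e o (double i) ≡ e i
interleave-even e o zero    = ≡.refl
interleave-even e o (suc i) = interleave-even (e ∘ suc) (o ∘ suc) i

interleave-odd : ∀ {a} {A : Set a} (e o : ℕ → A) i → interleave e o (odd i) ≡ o i
interleave-odd e o zero    = ≡.refl
interleave-odd e o (suc i) = interleave-odd (e ∘ suc) (o ∘ suc) i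

interleave-all : ∀ {a p} {A : Set a} (P : A → Set p) {e o : ℕ → A} →
  (∀ i → P (e i)) → (∀ i → P (o i)) → ∀ n → P (interleave e o n)
interleave-all P Pe Po zero          = Pe 0
interleave-all P Pe Po (suc zero)    = Po 0
interleave-all P Pe Po (suc (suc n)) = interleave-all P (Pe ∘ suc) (Po ∘ suc) n

module Matrices {c ℓ} (R : CommutativeRing c ℓ) where

  open CommutativeRing R hiding (zero)
  open import Algebra.Solver.Ring.NaturalCoefficients.Default commutativeSemiring
    using (solve; _:=_; _:+_; _:*_; con)

  Matrix : Set c
  Matrix = ℕ → ℕ → Carrier

  δ : Bool → Carrier
  δ b = if b then 1# else 0#

  -- Unlike ⌊ j ℕ.≟ i ⌋, the test j ≡ᵇ i reduces on suc j and suc i, so shifting both indices of I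
  -- is definitional.
  I : Matrix
  I i j = δ (j ≡ᵇ i)

  I-diagonal : ∀ i → I i i ≡ 1#
  I-diagonal zero    = ≡.refl
  I-diagonal (suc i) = I-diagonal i

  I-offDiagonal : ∀ {i j} → j ≢ i → I i j ≡ 0#
  I-offDiagonal {zero}  {zero}  j≢i = contradiction ≡.refl j≢i
  I-offDiagonal {zero}  {suc j} j≢i = ≡.refl
  I-offDiagonal {suc i} {zero}  j≢i = ≡.refl
  I-offDiagonal {suc i} {suc j} j≢i = I-offDiagonal (j≢i ∘ ≡.cong suc)

  bandRow-≡ᵇ : ∀ n j (a b c d : Carrier) →
    (if j ≡ᵇ suc n then a else if j ≡ᵇ n then b else if suc j ≡ᵇ n then c else if suc (suc j) ≡ᵇ n then d
     else 0#)
    ≈ I (suc n) j * a + I n j * b + I n (suc j) * c + I n (suc (suc j)) * d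
  bandRow-≡ᵇ zero                zero          a b c d =
    solve 4 (λ a b c d → b := con 0 :* a :+ con 1 :* b :+ con 0 :* c :+ con 0 :* d) refl a b c d
  bandRow-≡ᵇ zero                (suc zero)    a b c d =
    solve 4 (λ a b c d → a := con 1 :* a :+ con 0 :* b :+ con 0 :* c :+ con 0 :* d) refl a b c d
  bandRow-≡ᵇ zero                (suc (suc j)) a b c d =
    solve 4 (λ a b c d → con 0 := con 0 :* a :+ con 0 :* b :+ con 0 :* c :+ con 0 :* d) refl a b c d
  bandRow-≡ᵇ (suc zero)          zero          a b c d =
    solve 4 (λ a b c d → c := con 0 :* a :+ con 0 :* b :+ con 1 :* c :+ con 0 :* d) refl a b c d
  bandRow-≡ᵇ (suc (suc zero))    zero          a b c d =
    solve 4 (λ a b c d → d := con 0 :* a :+ con 0 :* b :+ con 0 :* c :+ con 1 :* d) refl a b c d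
  bandRow-≡ᵇ (suc (suc (suc n))) zero          a b c d =
    solve 4 (λ a b c d → con 0 := con 0 :* a :+ con 0 :* b :+ con 0 :* c :+ con 0 :* d) refl a b c d
  bandRow-≡ᵇ (suc n)             (suc j)       a b c d = bandRow-≡ᵇ n j a b c d

  bandRow : ∀ n j (a b c d : Carrier) →
    (if ⌊ j ℕ.≟ suc n ⌋ then a else if ⌊ j ℕ.≟ n ⌋ then b else if ⌊ suc j ℕ.≟ n ⌋ then c
     else if ⌊ suc (suc j) ℕ.≟ n ⌋ then d else 0#)
    ≈ I (suc n) j * a + I n j * b + I n (suc j) * c + I n (suc (suc j)) * d
  bandRow n j a b c d
    rewrite isYes≗does (j ℕ.≟ suc n) | isYes≗does (j ℕ.≟ n)
          | isYes≗does (suc j ℕ.≟ n) | isYes≗does (suc (suc j) ℕ.≟ n) = bandRow-≡ᵇ n j a b c d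

  -- Row i of the product of A with the lower bidiagonal matrix with diagonal d and entries l i at
  -- (i, i-1); as pred 0 = 0, the value l 0 multiplies row 0 a second time.
  lowerBidiag : (d l : ℕ → Carrier) → Matrix → Matrix
  lowerBidiag d l A i j = d i * A i j + l i * A (pred i) j

  upperBidiag : (d u : ℕ → Carrier) → Matrix → Matrix
  upperBidiag d u A i j = d i * A i j + u i * A (suc i) j

  I-odd : ∀ i j → I (odd i) (odd j) ≡ I i j
  I-odd i j = ≡.cong δ (double-≡ᵇ j i)

  module _ (d d′ e e′ : ℕ → Carrier) (A : Matrix) (i j : ℕ) where

    upperBidiag-even : upperBidiag (interleave d d′) (interleave e e′) A (double i) j
                     ≡ d i * A (double i) j + e i * A (odd i) j
    upperBidiag-even = ≡.cong₂ (λ x y → x * A (double i) j + y * A (odd i) j)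
                               (interleave-even d d′ i) (interleave-even e e′ i)

    upperBidiag-odd : upperBidiag (interleave d d′) (interleave e e′) A (odd i) j
                    ≡ d′ i * A (odd i) j + e′ i * A (double (suc i)) j
    upperBidiag-odd = ≡.cong₂ (λ x y → x * A (odd i) j + y * A (double (suc i)) j)
                              (interleave-odd d d′ i) (interleave-odd e e′ i)

    lowerBidiag-even : lowerBidiag (interleave d d′) (interleave e e′) A (double i) j
                     ≡ d i * A (double i) j + e i * A (pred (double i)) j
    lowerBidiag-even = ≡.cong₂ (λ x y → x * A (double i) j + y * A (pred (double i)) j)
                               (interleave-even d d′ i) (interleave-even e e′ i)

    lowerBidiag-odd : lowerBidiag (interleave d d′) (interleave e e′) A (odd i) j
                    ≡ d′ i * A (odd i) j + e′ i * A (double i) j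
    lowerBidiag-odd = ≡.cong₂ (λ x y → x * A (odd i) j + y * A (double i) j)
                              (interleave-odd d d′ i) (interleave-odd e e′ i)

  combineRows : ℕ → ℕ → Carrier → Carrier → Matrix → Matrix
  combineRows n m d l A i j with i ℕ.≟ n
  ... | yes _ = d * A n j + l * A m j
  ... | no  _ = A i j

  combineRows-at : ∀ n m d l A j → combineRows n m d l A n j ≡ d * A n j + l * A m j
  combineRows-at n m d l A j with n ℕ.≟ n
  ... | yes _  = ≡.refl
  ... | no n≢n = contradiction ≡.refl n≢n

  combineRows-elsewhere : ∀ n m d l A {i} j → i ≢ n → combineRows n m d l A i j ≡ A i j
  combineRows-elsewhere n m d l A {i} j i≢n with i ℕ.≟ n
  ... | yes i≡n = contradiction i≡n i≢n
  ... | no  _   = ≡.refl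

module TotalPositivity {c ℓ p} (R : CommutativeRing c ℓ) (cone : NonnegativeCone R p) where

  open CommutativeRing R hiding (zero)
  open NonnegativeCone cone
  open Determinant R
  open Matrices R public
  open import Algebra.Properties.CommutativeMonoid.Sum +-commutativeMonoid using (sum)
  open import Relation.Binary.Reasoning.Setoid setoid
  open import Algebra.Solver.Ring.NaturalCoefficients.Default commutativeSemiring
    using (solve; _:=_; _:+_; _:*_; con)

  submatrix : Matrix → ∀ {k} → (Fin k → ℕ) → (Fin k → ℕ) → SquareMatrix k
  submatrix A rows cols r c = A (rows r) (cols c)

  minor : Matrix → ∀ {k} → (Fin k → ℕ) → (Fin k → ℕ) → Carrier
  minor A rows cols = det (submatrix A rows cols)

  TotallyPositive : Matrix → Set p
  TotallyPositive A = ∀ k (rows cols : Fin k → ℕ) →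
    StrictlyIncreasing rows → StrictlyIncreasing cols → Nonneg (minor A rows cols)

  TP-resp : ∀ {A B} → (∀ i j → A i j ≈ B i j) → TotallyPositive A → TotallyPositive B
  TP-resp A≈B A-TP k rows cols rows↑ cols↑ =
    Nonneg-resp (det-cong λ r c → A≈B (rows r) (cols c)) (A-TP k rows cols rows↑ cols↑)

  TP-submatrix : ∀ {A} (f g : ℕ → ℕ) →
    (∀ {i j} → i ℕ.< j → f i ℕ.< f j) → (∀ {i j} → i ℕ.< j → g i ℕ.< g j) →
    TotallyPositive A → TotallyPositive (λ i j → A (f i) (g j))
  TP-submatrix f g f↑ g↑ A-TP k rows cols rows↑ cols↑ =
    A-TP k (f ∘ rows) (g ∘ cols) (λ r s → f↑ ∘ rows↑ r s) (λ r s → g↑ ∘ cols↑ r s)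

  identity-minor : ∀ {k} {rows cols : Fin k → ℕ} → StrictlyIncreasing rows → StrictlyIncreasing cols →
    minor I rows cols ≈ 0# ⊎ minor I rows cols ≈ 1#
  identity-minor {zero}                rows↑ cols↑ = inj₂ refl
  identity-minor {suc k} {rows} {cols} rows↑ cols↑ with ℕ.<-cmp (rows zero) (cols zero)
  ... | tri< r₀<c₀ _ _ = inj₁ (sum-zero λ j → laplaceTerm-entry≈0 (submatrix I rows cols) j (reflexive
          (I-offDiagonal λ cⱼ≡r₀ →
             ℕ.<-irrefl (≡.sym cⱼ≡r₀) (ℕ.<-≤-trans r₀<c₀ (increasing-mono-≤ cols↑ z≤n)))))
  ... | tri> _ _ c₀<r₀ = inj₁ (det-zeroColumn (submatrix I rows cols) zero λ r → reflexive
          (I-offDiagonal λ c₀≡rᵣ → ℕ.<-irrefl c₀≡rᵣ (ℕ.<-≤-trans c₀<r₀ (increasing-mono-≤ rows↑ z≤n))))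
  ... | tri≈ _ r₀≡c₀ _ = Sum.map (trans expand) (trans expand)
          (identity-minor (λ r s → rows↑ (suc r) (suc s) ∘ s≤s) (λ r s → cols↑ (suc r) (suc s) ∘ s≤s))
    where
    rest≈0 : ∀ j → laplaceTerm (submatrix I rows cols) (suc j) ≈ 0#
    rest≈0 j = laplaceTerm-entry≈0 (submatrix I rows cols) (suc j) (reflexive (I-offDiagonal λ cⱼ≡r₀ →
      ℕ.<-irrefl (≡.sym cⱼ≡r₀) (≡.subst (ℕ._< cols (suc j)) (≡.sym r₀≡c₀) (cols↑ zero (suc j) (s≤s z≤n)))))

    expand : minor I rows cols ≈ minor I (rows ∘ suc) (cols ∘ suc)
    expand = begin
      (1# * I (rows zero) (cols zero)) * minor I (rows ∘ suc) (cols ∘ suc)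
        + sum {k} (laplaceTerm (submatrix I rows cols) ∘ suc)
        ≈⟨ +-cong (*-congʳ (trans (*-identityˡ _) (reflexive
                    (≡.trans (≡.cong (λ r → I r (cols zero)) r₀≡c₀) (I-diagonal (cols zero))))))
                  (sum-zero {k} rest≈0) ⟩
      1# * minor I (rows ∘ suc) (cols ∘ suc) + 0#
        ≈⟨ trans (+-identityʳ _) (*-identityˡ _) ⟩
      minor I (rows ∘ suc) (cols ∘ suc) ∎

  TP-identity : TotallyPositive I
  TP-identity k rows cols rows↑ cols↑ =
    [ (λ m≈0 → Nonneg-resp (sym m≈0) Nonneg-0#) , (λ m≈1 → Nonneg-resp (sym m≈1) Nonneg-1#) ]
      (identity-minor rows↑ cols↑)

  -- Expanding the combined row gives d times a minor of A plus l times a determinant whose rows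
  -- are those of a minor of A or contain two equal adjacent rows.
  TP-combineRows : ∀ {n m d l A} → Nonneg d → Nonneg l →
    (∀ {k} {rows : Fin (suc k) → ℕ} {t} →
      StrictlyIncreasing rows → rows t ≡ n → IncreasingUpToRepeat (rows [ t ]≔ m)) →
    TotallyPositive A → TotallyPositive (combineRows n m d l A)
  TP-combineRows d≥0 l≥0 replace A-TP zero rows cols rows↑ cols↑ = Nonneg-1#
  TP-combineRows {n} {m} {d} {l} {A} d≥0 l≥0 replace A-TP (suc k) rows cols rows↑ cols↑
    with Fin.any? (λ t → rows t ℕ.≟ n)
  ... | no n∉rows = Nonneg-resp
          (det-cong λ r c → reflexive (≡.sym (combineRows-elsewhere n m d l A (cols c) (n∉rows ∘ (r ,_)))))
          (A-TP (suc k) rows cols rows↑ cols↑)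
  ... | yes (t , ≡.refl) = Nonneg-resp (sym expand)
          (Nonneg-+ (Nonneg-* d≥0 (A-TP (suc k) rows cols rows↑ cols↑)) (Nonneg-* l≥0 replaced≥0))
    where
    elsewhere : ∀ {r} c → r ≢ t → combineRows (rows t) m d l A (rows r) (cols c) ≡ A (rows r) (cols c)
    elsewhere c r≢t = combineRows-elsewhere (rows t) m d l A (cols c) (r≢t ∘ increasing-injective rows↑)

    expand : minor (combineRows (rows t) m d l A) rows cols ≈ d * minor A rows cols + l * minor A (rows [ t ]≔ m) cols
    expand = det-linear t d l
      (λ r r≢t c → reflexive (elsewhere c r≢t))
      (λ r r≢t c → reflexive (≡.trans (elsewhere c r≢t)
                                      (≡.cong (λ i → A i (cols c)) (≡.sym (updateAt-minimal r t rows r≢t)))))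
      (λ c → reflexive (≡.trans (combineRows-at (rows t) m d l A (cols c))
                                (≡.cong (λ i → d * A (rows t) (cols c) + l * A i (cols c))
                                        (≡.sym (updateAt-updates t rows)))))

    replaced≥0 : Nonneg (minor A (rows [ t ]≔ m) cols)
    replaced≥0 with replace rows↑ ≡.refl
    ... | inj₁ replaced↑      = A-TP (suc k) (rows [ t ]≔ m) cols replaced↑ cols↑
    ... | inj₂ (u , repeated) = Nonneg-resp
            (sym (det-equalAdjacentRows (submatrix A (rows [ t ]≔ m) cols) u λ c →
                    reflexive (≡.cong (λ i → A i (cols c)) repeated)))
            Nonneg-0#

  module _ (d l : ℕ → Carrier) where

    -- Rows N-1, …, 1, 0 are combined in this order, so row i is combined with the original row i-1.
    lowerSweep : ℕ → Matrix → Matrix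
    lowerSweep zero    A = A
    lowerSweep (suc N) A = lowerSweep N (combineRows N (pred N) (d N) (l N) A)

    lowerSweep-above : ∀ N A {i} j → N ℕ.≤ i → lowerSweep N A i j ≡ A i j
    lowerSweep-above zero    A j N≤i = ≡.refl
    lowerSweep-above (suc N) A j N<i = ≡.trans (lowerSweep-above N _ j (ℕ.<⇒≤ N<i))
      (combineRows-elsewhere N (pred N) (d N) (l N) A j λ i≡N → ℕ.<-irrefl (≡.sym i≡N) N<i)

    lowerSweep-below : ∀ N A {i} j → i ℕ.< N → lowerSweep N A i j ≡ lowerBidiag d l A i j
    lowerSweep-below (suc N) A {i} j i<1+N with ℕ.m<1+n⇒m<n∨m≡n i<1+N
    ... | inj₂ ≡.refl = ≡.trans (lowerSweep-above i _ j ℕ.≤-refl) (combineRows-at i (pred i) (d i) (l i) A j)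
    ... | inj₁ i<N    = ≡.trans (lowerSweep-below N _ j i<N) (≡.cong₂ (λ x y → d i * x + l i * y)
      (combineRows-elsewhere N (pred N) (d N) (l N) A j (ℕ.<⇒≢ i<N))
      (combineRows-elsewhere N (pred N) (d N) (l N) A j (ℕ.<⇒≢ (ℕ.≤-<-trans ℕ.pred[n]≤n i<N))))

    TP-lowerSweep : (∀ i → Nonneg (d i)) → (∀ i → Nonneg (l i)) →
      ∀ N {A} → TotallyPositive A → TotallyPositive (lowerSweep N A)
    TP-lowerSweep d≥0 l≥0 zero    A-TP = A-TP
    TP-lowerSweep d≥0 l≥0 (suc N) A-TP =
      TP-lowerSweep d≥0 l≥0 N (TP-combineRows (d≥0 N) (l≥0 N) replace-by-pred A-TP)

    TP-lowerBidiag : (∀ i → Nonneg (d i)) → (∀ i → Nonneg (l i)) →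
      ∀ {A} → TotallyPositive A → TotallyPositive (lowerBidiag d l A)
    TP-lowerBidiag d≥0 l≥0 {A} A-TP k rows cols rows↑ cols↑ =
      Nonneg-resp (det-cong λ r c → reflexive (lowerSweep-below (bound rows) A (cols c) (<-bound rows r)))
                  (TP-lowerSweep d≥0 l≥0 (bound rows) A-TP k rows cols rows↑ cols↑)

  module _ (d u : ℕ → Carrier) where

    -- Rows 0, 1, …, N-1 are combined in this order, so row i is combined with the original row i+1.
    upperSweep : ℕ → Matrix → Matrix
    upperSweep zero    A = A
    upperSweep (suc N) A = combineRows N (suc N) (d N) (u N) (upperSweep N A)

    upperSweep-above : ∀ N A {i} j → N ℕ.≤ i → upperSweep N A i j ≡ A i j
    upperSweep-above zero    A j N≤i = ≡.refl
    upperSweep-above (suc N) A j N<i = ≡.trans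
      (combineRows-elsewhere N (suc N) (d N) (u N) (upperSweep N A) j λ i≡N → ℕ.<-irrefl (≡.sym i≡N) N<i)
      (upperSweep-above N A j (ℕ.<⇒≤ N<i))

    upperSweep-below : ∀ N A {i} j → i ℕ.< N → upperSweep N A i j ≡ upperBidiag d u A i j
    upperSweep-below (suc N) A {i} j i<1+N with ℕ.m<1+n⇒m<n∨m≡n i<1+N
    ... | inj₂ ≡.refl = ≡.trans (combineRows-at i (suc i) (d i) (u i) (upperSweep i A) j)
      (≡.cong₂ (λ x y → d i * x + u i * y) (upperSweep-above i A j ℕ.≤-refl) (upperSweep-above i A j (ℕ.n≤1+n i)))
    ... | inj₁ i<N    = ≡.trans (combineRows-elsewhere N (suc N) (d N) (u N) (upperSweep N A) j (ℕ.<⇒≢ i<N))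
      (upperSweep-below N A j i<N)

    TP-upperSweep : (∀ i → Nonneg (d i)) → (∀ i → Nonneg (u i)) →
      ∀ N {A} → TotallyPositive A → TotallyPositive (upperSweep N A)
    TP-upperSweep d≥0 u≥0 zero    A-TP = A-TP
    TP-upperSweep d≥0 u≥0 (suc N) A-TP =
      TP-combineRows (d≥0 N) (u≥0 N) replace-by-suc (TP-upperSweep d≥0 u≥0 N A-TP)

    TP-upperBidiag : (∀ i → Nonneg (d i)) → (∀ i → Nonneg (u i)) →
      ∀ {A} → TotallyPositive A → TotallyPositive (upperBidiag d u A)
    TP-upperBidiag d≥0 u≥0 {A} A-TP k rows cols rows↑ cols↑ =
      Nonneg-resp (det-cong λ r c → reflexive (upperSweep-below (bound rows) A (cols c) (<-bound rows r)))
                  (TP-upperSweep d≥0 u≥0 (bound rows) A-TP k rows cols rows↑ cols↑)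

  -- L U + D is the odd-odd submatrix of stage₄, a product of four bidiagonal matrices (a planar network).
  module Network (l u w : ℕ → Carrier) where

    0s 1s : ℕ → Carrier
    0s = const 0#
    1s = const 1#

    LU+D : Matrix
    LU+D i j = lowerBidiag 1s l (upperBidiag u 1s I) i j + w i * I i j

    stage₁ stage₂ stage₃ stage₄ : Matrix
    stage₁ = upperBidiag (interleave 0s 1s) (interleave 1s 0s) I
    stage₂ = upperBidiag (interleave w u) (interleave 0s 1s) stage₁
    stage₃ = lowerBidiag (interleave 0s 1s) (interleave l 1s) stage₂
    stage₄ = lowerBidiag (interleave 0s 1s) (interleave 0s 1s) stage₃

    stage₂-even : ∀ i j → stage₂ (double i) (odd j) ≈ w i * I i j
    stage₂-even i j = begin
      stage₂ (double i) (odd j)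
        ≡⟨ upperBidiag-even w u 0s 1s stage₁ i (odd j) ⟩
      w i * stage₁ (double i) (odd j) + 0# * stage₁ (odd i) (odd j)
        ≡⟨ ≡.cong (λ x → w i * x + 0# * stage₁ (odd i) (odd j))
                  (upperBidiag-even 0s 1s 1s 0s I i (odd j)) ⟩
      w i * (0# * I (double i) (odd j) + 1# * I (odd i) (odd j)) + 0# * stage₁ (odd i) (odd j)
        ≈⟨ solve 4 (λ w a b s → w :* (con 0 :* a :+ con 1 :* b) :+ con 0 :* s := w :* b) refl (w i) _ _ _ ⟩
      w i * I (odd i) (odd j)
        ≡⟨ ≡.cong (w i *_) (I-odd i j) ⟩
      w i * I i j ∎

    stage₂-odd : ∀ i j → stage₂ (odd i) (odd j) ≈ u i * I i j + I (suc i) j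
    stage₂-odd i j = begin
      stage₂ (odd i) (odd j)
        ≡⟨ upperBidiag-odd w u 0s 1s stage₁ i (odd j) ⟩
      u i * stage₁ (odd i) (odd j) + 1# * stage₁ (double (suc i)) (odd j)
        ≡⟨ ≡.cong₂ (λ x y → u i * x + 1# * y) (upperBidiag-odd 0s 1s 1s 0s I i (odd j))
                                             (upperBidiag-even 0s 1s 1s 0s I (suc i) (odd j)) ⟩
      u i * (1# * I (odd i) (odd j) + 0# * I (double (suc i)) (odd j))
        + 1# * (0# * I (double (suc i)) (odd j) + 1# * I (odd (suc i)) (odd j))
        ≈⟨ solve 4 (λ u a b e → u :* (con 1 :* a :+ con 0 :* b) :+ con 1 :* (con 0 :* b :+ con 1 :* e)
                                := u :* a :+ e)
                   refl (u i) _ _ _ ⟩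
      u i * I (odd i) (odd j) + I (odd (suc i)) (odd j)
        ≡⟨ ≡.cong₂ (λ x y → u i * x + y) (I-odd i j) (I-odd (suc i) j) ⟩
      u i * I i j + I (suc i) j ∎

    stage₄-odd : ∀ i c →
      stage₄ (odd i) c ≈ (stage₂ (odd i) c + stage₂ (double i) c) + l i * stage₂ (pred (double i)) c
    stage₄-odd i c = begin
      stage₄ (odd i) c
        ≡⟨ lowerBidiag-odd 0s 1s 0s 1s stage₃ i c ⟩
      1# * stage₃ (odd i) c + 1# * stage₃ (double i) c
        ≡⟨ ≡.cong₂ (λ x y → 1# * x + 1# * y) (lowerBidiag-odd 0s 1s l 1s stage₂ i c)
                                             (lowerBidiag-even 0s 1s l 1s stage₂ i c) ⟩
      1# * (1# * stage₂ (odd i) c + 1# * stage₂ (double i) c)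
        + 1# * (0# * stage₂ (double i) c + l i * stage₂ (pred (double i)) c)
        ≈⟨ solve 4 (λ a b l e → con 1 :* (con 1 :* a :+ con 1 :* b) :+ con 1 :* (con 0 :* b :+ l :* e)
                                := (a :+ b) :+ l :* e)
                   refl _ _ (l i) _ ⟩
      (stage₂ (odd i) c + stage₂ (double i) c) + l i * stage₂ (pred (double i)) c ∎

    stage₄-odd-odd : l 0 ≈ 0# → ∀ i j → stage₄ (odd i) (odd j) ≈ LU+D i j
    stage₄-odd-odd l₀≈0 zero j = begin
      stage₄ 1 (odd j)
        ≈⟨ trans (stage₄-odd 0 (odd j)) (+-cong (+-cong (stage₂-odd 0 j) (stage₂-even 0 j)) (*-congʳ l₀≈0)) ⟩
      ((u 0 * I 0 j + I 1 j) + w 0 * I 0 j) + 0# * stage₂ 0 (odd j)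
        ≈⟨ solve 5 (λ u a b w s → ((u :* a :+ b) :+ w :* a) :+ con 0 :* s
                                  := (con 1 :* (u :* a :+ con 1 :* b) :+ con 0 :* (u :* a :+ con 1 :* b)) :+ w :* a)
                   refl (u 0) (I 0 j) (I 1 j) (w 0) _ ⟩
      (1# * (u 0 * I 0 j + 1# * I 1 j) + 0# * (u 0 * I 0 j + 1# * I 1 j)) + w 0 * I 0 j
        ≈⟨ +-congʳ (+-congˡ (*-congʳ (sym l₀≈0))) ⟩
      LU+D 0 j ∎
    stage₄-odd-odd l₀≈0 (suc i) j = begin
      stage₄ (odd (suc i)) (odd j)
        ≈⟨ trans (stage₄-odd (suc i) (odd j))
                 (+-cong (+-cong (stage₂-odd (suc i) j) (stage₂-even (suc i) j)) (*-congˡ (stage₂-odd i j))) ⟩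
      ((u (suc i) * I (suc i) j + I (suc (suc i)) j) + w (suc i) * I (suc i) j)
        + l (suc i) * (u i * I i j + I (suc i) j)
        ≈⟨ solve 7 (λ u a b w l u′ a′ → ((u :* a :+ b) :+ w :* a) :+ l :* (u′ :* a′ :+ a)
                                        := (con 1 :* (u :* a :+ con 1 :* b) :+ l :* (u′ :* a′ :+ con 1 :* a)) :+ w :* a)
                   refl (u (suc i)) (I (suc i) j) (I (suc (suc i)) j) (w (suc i)) (l (suc i)) (u i) (I i j) ⟩
      LU+D (suc i) j ∎

    TP-stage₄ : (∀ i → Nonneg (l i)) → (∀ i → Nonneg (u i)) → (∀ i → Nonneg (w i)) → TotallyPositive stage₄
    TP-stage₄ l≥0 u≥0 w≥0 =
      TP-lowerBidiag _ _ (interleave-all Nonneg 0≥0 1≥0) (interleave-all Nonneg 0≥0 1≥0) {stage₃}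
      (TP-lowerBidiag _ _ (interleave-all Nonneg 0≥0 1≥0) (interleave-all Nonneg l≥0 1≥0) {stage₂}
      (TP-upperBidiag _ _ (interleave-all Nonneg w≥0 u≥0) (interleave-all Nonneg 0≥0 1≥0) {stage₁}
      (TP-upperBidiag _ _ (interleave-all Nonneg 0≥0 1≥0) (interleave-all Nonneg 1≥0 0≥0) {I} TP-identity)))
      where
      0≥0 : ∀ i → Nonneg (0s i)
      0≥0 _ = Nonneg-0#
      1≥0 : ∀ i → Nonneg (1s i)
      1≥0 _ = Nonneg-1#

  TP-LU+D : ∀ {l u w} → l 0 ≈ 0# → (∀ i → Nonneg (l i)) → (∀ i → Nonneg (u i)) → (∀ i → Nonneg (w i)) →
    TotallyPositive (Network.LU+D l u w)
  TP-LU+D {l} {u} {w} l₀≈0 l≥0 u≥0 w≥0 =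
    TP-resp (stage₄-odd-odd l₀≈0) (TP-submatrix {stage₄} odd odd odd-mono odd-mono (TP-stage₄ l≥0 u≥0 w≥0))
    where open Network l u w

-- Row n of P (left) and of L (L Uₓ + λ I) (right) in terms of the Kronecker deltas a⁺ a a₁ a₂ of
-- columns n+1, n, n-1, n-2, for n ≥ 2, n = 1 and n = 0; N and N′ stand for n and n - 1.
module RowIdentities {c ℓ} (R : CommutativeRing c ℓ) where

  open CommutativeRing R
  open import Algebra.Solver.Ring.NaturalCoefficients.Default commutativeSemiring
    using (solve; _:=_; _:+_; _:*_; con)

  row-identity : ∀ a⁺ a a₁ a₂ x l N N′ →
    a⁺ * 1# + a * (((N + N) + l) + x) + a₁ * (N * (N′ + l) + (N + N) * x) + a₂ * ((N * N′) * x)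
    ≈ 1# * ((1# * (x * a + 1# * a⁺) + N * (x * a₁ + 1# * a)) + l * a)
      + N * ((1# * (x * a₁ + 1# * a) + N′ * (x * a₂ + 1# * a₁)) + l * a₁)
  row-identity = solve 8 (λ a⁺ a a₁ a₂ x l N N′ →
    a⁺ :* con 1 :+ a :* (((N :+ N) :+ l) :+ x) :+ a₁ :* (N :* (N′ :+ l) :+ (N :+ N) :* x) :+ a₂ :* ((N :* N′) :* x)
    := con 1 :* ((con 1 :* (x :* a :+ con 1 :* a⁺) :+ N :* (x :* a₁ :+ con 1 :* a)) :+ l :* a)
       :+ N :* ((con 1 :* (x :* a₁ :+ con 1 :* a) :+ N′ :* (x :* a₂ :+ con 1 :* a₁)) :+ l :* a₁)) refl

  row-identity₁ : ∀ a⁺ a a₁ x l →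
    a⁺ * 1# + a * (((1# + 1#) + l) + x) + a₁ * (1# * (0# + l) + (1# + 1#) * x) + 0# * ((1# * 0#) * x)
    ≈ 1# * ((1# * (x * a + 1# * a⁺) + 1# * (x * a₁ + 1# * a)) + l * a)
      + 1# * ((1# * (x * a₁ + 1# * a) + 0# * (x * a₁ + 1# * a)) + l * a₁)
  row-identity₁ = solve 5 (λ a⁺ a a₁ x l →
    a⁺ :* con 1 :+ a :* (((con 1 :+ con 1) :+ l) :+ x) :+ a₁ :* (con 1 :* (con 0 :+ l) :+ (con 1 :+ con 1) :* x)
      :+ con 0 :* ((con 1 :* con 0) :* x)
    := con 1 :* ((con 1 :* (x :* a :+ con 1 :* a⁺) :+ con 1 :* (x :* a₁ :+ con 1 :* a)) :+ l :* a)
       :+ con 1 :* ((con 1 :* (x :* a₁ :+ con 1 :* a) :+ con 0 :* (x :* a₁ :+ con 1 :* a)) :+ l :* a₁)) refl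

  row-identity₀ : ∀ a⁺ a x l →
    a⁺ * 1# + a * (((0# + 0#) + l) + x) + 0# * (0# * (0# + l) + (0# + 0#) * x) + 0# * ((0# * 0#) * x)
    ≈ 1# * ((1# * (x * a + 1# * a⁺) + 0# * (x * a + 1# * a⁺)) + l * a)
      + 0# * ((1# * (x * a + 1# * a⁺) + 0# * (x * a + 1# * a⁺)) + l * a)
  row-identity₀ = solve 4 (λ a⁺ a x l →
    a⁺ :* con 1 :+ a :* (((con 0 :+ con 0) :+ l) :+ x) :+ con 0 :* (con 0 :* (con 0 :+ l) :+ (con 0 :+ con 0) :* x)
      :+ con 0 :* ((con 0 :* con 0) :* x)
    := con 1 :* ((con 1 :* (x :* a :+ con 1 :* a⁺) :+ con 0 :* (x :* a :+ con 1 :* a⁺)) :+ l :* a)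
       :+ con 0 :* ((con 1 :* (x :* a :+ con 1 :* a⁺) :+ con 0 :* (x :* a :+ con 1 :* a⁺)) :+ l :* a)) refl

0≤* : ∀ {x y} → 0ℤ ℤ.≤ x → 0ℤ ℤ.≤ y → 0ℤ ℤ.≤ x ℤ.* y
0≤* {+ m} {+ n} _ _ = ≡.subst (0ℤ ℤ.≤_) (ℤ.pos-* m n) (+≤+ z≤n)

0≤sumℤ : ∀ n {f} → (∀ i → 0ℤ ℤ.≤ f i) → 0ℤ ℤ.≤ sumℤ n f
0≤sumℤ zero    f≥0 = +≤+ z≤n
0≤sumℤ (suc n) f≥0 = ℤ.+-mono-≤ (0≤sumℤ n f≥0) (f≥0 n)

NonNeg-nat : ∀ n → NonNeg (nat n)
NonNeg-nat n zero    zero    = +≤+ z≤n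
NonNeg-nat n zero    (suc b) = +≤+ z≤n
NonNeg-nat n (suc a) b       = +≤+ z≤n

NonNeg-X : NonNeg X
NonNeg-X zero          b       = +≤+ z≤n
NonNeg-X (suc zero)    zero    = +≤+ z≤n
NonNeg-X (suc zero)    (suc b) = +≤+ z≤n
NonNeg-X (suc (suc a)) b       = +≤+ z≤n

NonNeg-Λ : NonNeg Λ
NonNeg-Λ zero    zero          = +≤+ z≤n
NonNeg-Λ zero    (suc zero)    = +≤+ z≤n
NonNeg-Λ zero    (suc (suc b)) = +≤+ z≤n
NonNeg-Λ (suc a) zero          = +≤+ z≤n
NonNeg-Λ (suc a) (suc b)       = +≤+ z≤n

coefficientwise : NonnegativeCone seriesRing 0ℓ
coefficientwise = record
  { Nonneg      = NonNeg
  ; Nonneg-resp = λ s≈t s≥0 a b → ≡.subst (0ℤ ℤ.≤_) (s≈t a b) (s≥0 a b)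
  ; Nonneg-0#   = NonNeg-nat 0
  ; Nonneg-1#   = NonNeg-nat 1
  ; Nonneg-+    = λ s≥0 t≥0 a b → ℤ.+-mono-≤ (s≥0 a b) (t≥0 a b)
  ; Nonneg-*    = λ s≥0 t≥0 a b → 0≤sumℤ (suc a) λ i → 0≤sumℤ (suc b) λ j → 0≤* (s≥0 i j) (t≥0 _ _)
  }

open Defs using (Matrix; _≈ₘ_; _+ₘ_; _∙ₘ_; sumS; _·ₘ_; I; Δ; Ux; L; P; sumFin; sign; det; TotallyPositive)

module SeriesDet = Determinant seriesRing
module SeriesTP = TotalPositivity seriesRing coefficientwise
module SeriesSum = RangeSum seriesRing
open SeriesTP using (δ) renaming (I to 𝟙)
-- A series is a function, so unification eta-expands equations between series coefficientwise and
-- cannot infer the implicit arguments of the congruences below; they are given explicitly.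
open CommutativeRing seriesRing
  using (_≈_; _+_; _*_; 0#; refl; sym; trans; reflexive; setoid; +-cong; *-cong; *-congʳ; *-congˡ; +-congʳ; +-congˡ;
         +-comm; +-identityˡ; +-identityʳ; *-identityˡ; zeroˡ; +-commutativeMonoid)
open import Algebra.Properties.CommutativeMonoid.Sum +-commutativeMonoid using (sum)
open import Relation.Binary.Reasoning.Setoid setoid

sign≈sign : ∀ n → sign n ≈ SeriesDet.sign n
sign≈sign zero          = refl
sign≈sign (suc zero)    = -1≈-1
  where
  -1≈-1 : cst -1ℤ ≈ₛ (-ₛ 1ₛ)
  -1≈-1 zero    zero    = ≡.refl
  -1≈-1 zero    (suc b) = ≡.refl
  -1≈-1 (suc a) b       = ≡.refl
sign≈sign (suc (suc n)) = sign≈sign n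

sumFin≈sum : ∀ {k} {f g : Fin k → Series} → (∀ j → f j ≈ g j) → sumFin f ≈ sum g
sumFin≈sum {zero}  f≈g = refl
sumFin≈sum {suc k} f≈g = +-cong (f≈g zero) (sumFin≈sum (f≈g ∘ suc))

det≈det : ∀ {k} (M : Fin k → Fin k → Series) → det M ≈ SeriesDet.det M
det≈det {zero}  M = refl
det≈det {suc k} M = sumFin≈sum {suc k} λ j →
  *-cong (*-congʳ {M zero j} (sign≈sign (toℕ j))) (det≈det (SeriesDet.minor₀ M j))

TP⇒TotallyPositive : ∀ {A} → SeriesTP.TotallyPositive A → TotallyPositive A
TP⇒TotallyPositive {A} A-TP k rows cols rows↑ cols↑ =
  NonnegativeCone.Nonneg-resp coefficientwise (sym (det≈det (SeriesTP.submatrix A rows cols)))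
                                               (A-TP k rows cols rows↑ cols↑)

I≡𝟙 : ∀ i j → I i j ≡ 𝟙 i j
I≡𝟙 i j = ≡.cong δ (isYes≗does (j ℕ.≟ i))

⌊≟⌋-refl : ∀ n → ⌊ n ℕ.≟ n ⌋ ≡ true
⌊≟⌋-refl n = ≡.cong ⌊_⌋ (ℕ.≟-diag ≡.refl)

⌊≟⌋-≢ : ∀ {m n} → m ≢ n → ⌊ m ℕ.≟ n ⌋ ≡ false
⌊≟⌋-≢ {m} {n} m≢n = ≡.trans (isYes≗does (m ℕ.≟ n)) (dec-false (m ℕ.≟ n) m≢n)

L-diagonal : ∀ n → L n n ≡ 1ₛ
L-diagonal n = ≡.cong (λ b → if b then 1ₛ else (if ⌊ suc n ℕ.≟ n ⌋ then nat n else 0ₛ)) (⌊≟⌋-refl n)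

L-subdiagonal : ∀ n → L (suc n) n ≡ nat (suc n)
L-subdiagonal n = ≡.cong₂ (λ b b′ → if b then 1ₛ else (if b′ then nat (suc n) else 0ₛ))
  (⌊≟⌋-≢ {n} (ℕ.1+n≢n ∘ ≡.sym)) (⌊≟⌋-refl (suc n))

L-below : ∀ {n k} → suc k ℕ.< n → L n k ≡ 0ₛ
L-below {n} {k} 1+k<n = ≡.cong₂ (λ b b′ → if b then 1ₛ else (if b′ then nat n else 0ₛ))
  (⌊≟⌋-≢ (ℕ.<⇒≢ (ℕ.<-trans (ℕ.n<1+n k) 1+k<n))) (⌊≟⌋-≢ (ℕ.<⇒≢ 1+k<n))

sumS≡∑ : ∀ n f → sumS n f ≡ SeriesSum.∑ n f
sumS≡∑ zero    f = ≡.refl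
sumS≡∑ (suc n) f = ≡.cong (_+ₛ f n) (sumS≡∑ n f)

L·≈lowerBidiag : ∀ B i j → (L ·ₘ B) i j ≈ SeriesTP.lowerBidiag (const 1ₛ) nat B i j
L·≈lowerBidiag B zero    j =
  trans (+-identityˡ (1ₛ * B 0 j)) (sym (trans (+-congˡ {1ₛ * B 0 j} (zeroˡ (B 0 j))) (+-identityʳ (1ₛ * B 0 j))))
L·≈lowerBidiag B (suc i) j = begin
  sumS (suc (suc i)) (λ k → L (suc i) k *ₛ B k j)
    ≡⟨ sumS≡∑ (suc (suc i)) _ ⟩
  (SeriesSum.∑ i (λ k → L (suc i) k *ₛ B k j) + L (suc i) i * B i j) + L (suc i) (suc i) * B (suc i) j
    ≈⟨ +-cong (+-cong (trans (SeriesSum.∑-cong i λ k k<i →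
                               trans (*-congʳ {B k j} (reflexive (L-below (ℕ.s≤s k<i)))) (zeroˡ (B k j)))
                             (SeriesSum.∑-zero i))
                      (*-congʳ {B i j} (reflexive (L-subdiagonal i))))
              (*-congʳ {B (suc i) j} (reflexive (L-diagonal (suc i)))) ⟩
  (0# + nat (suc i) * B i j) + 1ₛ * B (suc i) j
    ≈⟨ trans (+-congʳ {1ₛ * B (suc i) j} (+-identityˡ (nat (suc i) * B i j)))
             (+-comm (nat (suc i) * B i j) (1ₛ * B (suc i) j)) ⟩
  1ₛ * B (suc i) j + nat (suc i) * B i j ∎

nat-+ : ∀ m n → nat (m ℕ.+ n) ≈ₛ (nat m +ₛ nat n)
nat-+ m n zero    zero    = ℤ.pos-+ m n
nat-+ m n zero    (suc b) = ≡.refl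
nat-+ m n (suc a) b       = ≡.refl

nat-double : ∀ n → nat (2 ℕ.* n) ≈ nat n + nat n
nat-double n = trans (reflexive (≡.cong (λ m → nat (n ℕ.+ m)) (ℕ.+-identityʳ n))) (nat-+ n n)

LUₓ+ΛI : Matrix
LUₓ+ΛI = (L ·ₘ Ux) +ₘ (Λ ∙ₘ I)

module Tridiagonal = SeriesTP.Network nat (const X) (const Λ)

Ux≈upperBidiag : ∀ i j → Ux i j ≈ SeriesTP.upperBidiag (const X) (const 1ₛ) 𝟙 i j
Ux≈upperBidiag i j = trans (+-comm (Δ i j) (X * I i j))
  (+-cong (*-congˡ {X} (reflexive (I≡𝟙 i j))) (trans (reflexive (I≡𝟙 (suc i) j)) (sym (*-identityˡ (𝟙 (suc i) j)))))

LUₓ+ΛI≈LU+D : ∀ i j → LUₓ+ΛI i j ≈ Tridiagonal.LU+D i j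
LUₓ+ΛI≈LU+D i j = +-cong
  (trans (L·≈lowerBidiag Ux i j)
         (+-cong (*-congˡ {1ₛ} (Ux≈upperBidiag i j)) (*-congˡ {nat i} (Ux≈upperBidiag (pred i) j))))
  (*-congˡ {Λ} (reflexive (I≡𝟙 i j)))

module Identities = RowIdentities seriesRing

P≈band : ∀ n j → P n j ≈ 𝟙 (suc n) j * 1ₛ + 𝟙 n j * (((nat n + nat n) + Λ) + X)
                         + 𝟙 n (suc j) * (nat n * (nat (n ∸ 1) + Λ) + (nat n + nat n) * X)
                         + 𝟙 n (suc (suc j)) * ((nat n * nat (n ∸ 1)) * X)
P≈band n j =
  trans (SeriesTP.bandRow n j 1ₛ ((nat (2 ℕ.* n) + Λ) + X) (nat n * (nat (n ∸ 1) + Λ) + nat (2 ℕ.* n) * X)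
                                 ((nat n * nat (n ∸ 1)) * X))
  (+-congʳ {𝟙 n (suc (suc j)) * ((nat n * nat (n ∸ 1)) * X)}
    (+-cong (+-congˡ {𝟙 (suc n) j * 1ₛ} (*-congˡ {𝟙 n j} (+-congʳ {X} (+-congʳ {Λ} (nat-double n)))))
            (*-congˡ {𝟙 n (suc j)} (+-congˡ {nat n * (nat (n ∸ 1) + Λ)} (*-congʳ {X} (nat-double n))))))

row-expansion : ∀ n j →
  𝟙 (suc n) j * 1ₛ + 𝟙 n j * (((nat n + nat n) + Λ) + X)
  + 𝟙 n (suc j) * (nat n * (nat (n ∸ 1) + Λ) + (nat n + nat n) * X)
  + 𝟙 n (suc (suc j)) * ((nat n * nat (n ∸ 1)) * X)
  ≈ 1ₛ * Tridiagonal.LU+D n j + nat n * Tridiagonal.LU+D (pred n) j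
row-expansion zero          j = Identities.row-identity₀ (𝟙 1 j) (𝟙 0 j) X Λ
row-expansion (suc zero)    j = Identities.row-identity₁ (𝟙 2 j) (𝟙 1 j) (𝟙 0 j) X Λ
row-expansion (suc (suc m)) j =
  Identities.row-identity (𝟙 (3 ℕ.+ m) j) (𝟙 (2 ℕ.+ m) j) (𝟙 (1 ℕ.+ m) j) (𝟙 m j) X Λ
                          (nat (2 ℕ.+ m)) (nat (1 ℕ.+ m))

P≈L·LUₓ+ΛI : P ≈ₘ (L ·ₘ LUₓ+ΛI)
P≈L·LUₓ+ΛI n j = trans (P≈band n j) (trans (row-expansion n j) (sym (trans (L·≈lowerBidiag LUₓ+ΛI n j)
  (+-cong (*-congˡ {1ₛ} (LUₓ+ΛI≈LU+D n j)) (*-congˡ {nat n} (LUₓ+ΛI≈LU+D (pred n) j))))))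

TP-LUₓ+ΛI : SeriesTP.TotallyPositive LUₓ+ΛI
TP-LUₓ+ΛI = SeriesTP.TP-resp {Tridiagonal.LU+D} (λ i j → sym (LUₓ+ΛI≈LU+D i j))
  (SeriesTP.TP-LU+D {nat} {const X} {const Λ} refl NonNeg-nat (λ _ → NonNeg-X) (λ _ → NonNeg-Λ))

proposition5p2 : (P ≈ₘ (L ·ₘ ((L ·ₘ Ux) +ₘ (Λ ∙ₘ I)))) × TotallyPositive P
proposition5p2 = P≈L·LUₓ+ΛI , TP⇒TotallyPositive {P} (SeriesTP.TP-resp {L·LUₓ+ΛI} L·LUₓ+ΛI≈P TP-L·LUₓ+ΛI)
  where
  L·LUₓ+ΛI : Matrix
  L·LUₓ+ΛI = SeriesTP.lowerBidiag (const 1ₛ) nat LUₓ+ΛI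

  L·LUₓ+ΛI≈P : ∀ i j → L·LUₓ+ΛI i j ≈ P i j
  L·LUₓ+ΛI≈P i j = sym (trans (P≈L·LUₓ+ΛI i j) (L·≈lowerBidiag LUₓ+ΛI i j))

  TP-L·LUₓ+ΛI : SeriesTP.TotallyPositive L·LUₓ+ΛI
  TP-L·LUₓ+ΛI = SeriesTP.TP-lowerBidiag (const 1ₛ) nat (λ _ → NonNeg-nat 1) NonNeg-nat {LUₓ+ΛI} TP-LUₓ+ΛI
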